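{- Let $G$ be an $n$-vertex $\alpha$-joint graph for some $\alpha>0$ and let $d\ge1$. Then every induced subgraph of $G$ on at least $10\alpha dn$ vertices contains a non-empty $(\alpha n,d)$-expanding subgraph.
   Context: An $n$-vertex graph $F$ is $\alpha$-joint if for every pair of disjoint sets $S,T\subseteq V(F)$ with $|S|,|T|\ge\alpha n$ there is at least one edge between $S$ and $T$. For a graph $H$ and $X\subseteq V(H)$, $\Gamma_H(X)$ denotes the set of vertices of $H$ adjacent to some vertex of $X$. $H$ is $(s,d)$-expanding if every $X\subseteq V(H)$ with $1\le|X|\le s$ satisfies $|\Gamma_H(X)|\ge d|X|$.
   Formalization: The parameters α and d are taken in the rationals. -}

module Defs where

open import Data.Nat using (ℕ; zero; suc)
open import Data.Bool using (Bool; true; false; _∧_; _∨_)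
open import Data.Fin using (Fin)
import Data.Fin as Fin
open import Data.Fin.Subset using (Subset; _∈_; _∉_; _⊆_; ∣_∣)
open import Data.Vec using (tabulate; lookup)
open import Data.Integer using (+_)
open import Data.Rational using (ℚ; _/_; _≤_; _*_)
open import Data.Product using (Σ; _×_; ∃)
open import Relation.Binary.PropositionalEquality using (_≡_)

ℕtoℚ : ℕ → ℚ
ℕtoℚ k = (+ k) / 1

record Graph (n : ℕ) : Set where
  field
    adj    : Fin n → Fin n → Bool
    sym    : ∀ u v → adj u v ≡ adj v u
    irrefl : ∀ v → adj v v ≡ false
open Graph public

EdgeBetween : ∀ {n} → Graph n → Subset n → Subset n → Set
EdgeBetween G S T = Σ _ λ s → Σ _ λ t → s ∈ S × t ∈ T × adj G s t ≡ true

Disjoint : ∀ {n} → Subset n → Subset n → Set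
Disjoint S T = ∀ x → x ∈ S → x ∉ T

Joint : ∀ {n} → ℚ → Graph n → Set
Joint {n} α F = ∀ (S T : Subset n) → Disjoint S T →
  α * ℕtoℚ n ≤ ℕtoℚ ∣ S ∣ → α * ℕtoℚ n ≤ ℕtoℚ ∣ T ∣ → EdgeBetween F S T

-- A subgraph H of G whose vertex set lies inside U (i.e. a subgraph of the
-- induced subgraph G[U]).
record SubgraphIn {n : ℕ} (G : Graph n) (U : Subset n) : Set where
  field
    verts    : Subset n
    verts⊆U  : verts ⊆ U
    hadj     : Fin n → Fin n → Bool
    hsym     : ∀ u v → hadj u v ≡ hadj v u
    hedge    : ∀ u v → hadj u v ≡ true → u ∈ verts × v ∈ verts × adj G u v ≡ true
open SubgraphIn public

anyFin : ∀ {n} → (Fin n → Bool) → Bool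
anyFin {zero}  f = false
anyFin {suc n} f = f Fin.zero ∨ anyFin (λ i → f (Fin.suc i))

Γ : ∀ {n} {G : Graph n} {U : Subset n} → SubgraphIn G U → Subset n → Subset n
Γ H X = tabulate λ v → anyFin λ u → lookup X u ∧ hadj H u v

Expanding : ∀ {n} {G : Graph n} {U : Subset n} → ℚ → ℚ → SubgraphIn G U → Set
Expanding {n} s d H = ∀ (X : Subset n) → X ⊆ verts H → 1 Data.Nat.≤ ∣ X ∣ →
  ℕtoℚ ∣ X ∣ ≤ s → d * ℕtoℚ ∣ X ∣ ≤ ℕtoℚ ∣ Γ H X ∣

-- Grow a set B ⊆ U from ∅: while G[U ─ B] has a set X with 1 ≤ |X| ≤ αn whose
-- neighbourhood has fewer than d|X| vertices, replace B by B ∪ X.  Then B stays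
-- sparse: its boundary ∂B (the neighbours of B in U ─ B) has at most d|B| vertices.
-- Jointness keeps a sparse B below αn: if αn ≤ |B| ≤ 2αn, the vertices T of U
-- outside B ∪ ∂B have no neighbour in B, so |T| < αn, and then
-- |U| ≤ |B| + |∂B| + |T| < 2αn + 2dαn + αn ≤ 5dαn < 10αdn.  Each step adds a vertex,
-- so the process stops, at a B with |B| < αn ≤ |U|; G[U ─ B] is then non-empty
-- and (αn, d)-expanding.
module Submission where

open import Defs hiding (sym)
open import Data.Nat using (ℕ)
open import Data.Fin.Subset using (Subset; ∣_∣)
open import Data.Rational using (ℚ; _<_; _≤_; _*_; 0ℚ; 1ℚ)
open import Data.Product using (Σ; _×_)

open import Data.Bool using (Bool; true; false; _∧_)
open import Data.Bool.Properties using (∧-comm; ∧-conicalˡ; ∧-conicalʳ)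
open import Data.Empty using (⊥-elim)
open import Data.Fin using (Fin)
import Data.Fin as Fin
open import Data.Fin.Subset using (_∈_; _∉_; _⊆_; _∪_; _∩_; _─_; ⊥; outside; inside)
open import Data.Fin.Subset.Properties
  using (_∈?_; _⊆?_; anySubset?; ∉⊥; ∣⊥∣≡0; ∣p∣≤n; p⊆q⇒∣p∣≤∣q∣; p─q⊆p; x∈p∧x∉q⇒x∈p─q;
         x∈p∪q⁺; x∈p∪q⁻; x∈p∩q⁺; x∈p∩q⁻)
import Data.Integer as ℤ
import Data.Integer.Properties as ℤₚ
open import Data.Maybe using (nothing)
import Data.Nat as ℕ
open import Data.Nat.Coprimality as Coprimality using ()
open import Data.Nat.Induction using (<-wellFounded)
import Data.Nat.Properties as ℕₚ
open import Data.Product using (_,_; ∃; proj₁; proj₂)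
open import Data.Rational using (mkℚ; _+_; _/_; *≤*; nonNegative)
import Data.Rational.Properties as ℚₚ
open import Data.Sum using (_⊎_; inj₁; inj₂; [_,_]′)
open import Data.Vec using (tabulate; lookup; []; _∷_; here; there)
open import Data.Vec.Properties using (lookup∘tabulate; []=⇒lookup; lookup⇒[]=)
open import Induction.WellFounded using (Acc; acc)
open import Function using (_∘_)
open import Relation.Binary.PropositionalEquality
open import Relation.Nullary using (¬_; Dec; yes; no)
open import Relation.Nullary.Decidable using (_×-dec_; decidable-stable)
open import Tactic.RingSolver using (solve-∀)
open import Tactic.RingSolver.Core.AlmostCommutativeRing using (AlmostCommutativeRing; fromCommutativeRing)

ℕtoℚ≡mkℚ : ∀ k → ℕtoℚ k ≡ mkℚ (ℤ.+ k) 0 (Coprimality.sym (Coprimality.1-coprimeTo k))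
ℕtoℚ≡mkℚ k = ℚₚ.normalize-coprime (Coprimality.sym (Coprimality.1-coprimeTo k))

ℕtoℚ-mono-≤ : ∀ {m k} → m ℕ.≤ k → ℕtoℚ m ≤ ℕtoℚ k
ℕtoℚ-mono-≤ {m} {k} m≤k = subst₂ _≤_ (sym (ℕtoℚ≡mkℚ m)) (sym (ℕtoℚ≡mkℚ k))
  (*≤* (subst₂ ℤ._≤_ (sym (ℤₚ.*-identityʳ (ℤ.+ m))) (sym (ℤₚ.*-identityʳ (ℤ.+ k))) (ℤ.+≤+ m≤k)))

ℕtoℚ-cancel-< : ∀ {m k} → ℕtoℚ m < ℕtoℚ k → m ℕ.< k
ℕtoℚ-cancel-< {m} {k} m<k = ℕₚ.≰⇒> λ k≤m → ℚₚ.<-irrefl refl (ℚₚ.<-≤-trans m<k (ℕtoℚ-mono-≤ k≤m))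

ℕtoℚ-homo-+ : ∀ m k → ℕtoℚ (m ℕ.+ k) ≡ ℕtoℚ m + ℕtoℚ k
ℕtoℚ-homo-+ m k = trans (cong (_/ 1) numerators) (sym (cong₂ _+_ (ℕtoℚ≡mkℚ m) (ℕtoℚ≡mkℚ k)))
  where
  numerators : ℤ.+ (m ℕ.+ k) ≡ ℤ.+ m ℤ.* ℤ.+ 1 ℤ.+ ℤ.+ k ℤ.* ℤ.+ 1
  numerators = trans (ℤₚ.pos-+ m k) (sym (cong₂ ℤ._+_ (ℤₚ.*-identityʳ (ℤ.+ m)) (ℤₚ.*-identityʳ (ℤ.+ k))))

ℚ-ring : AlmostCommutativeRing _ _
ℚ-ring = fromCommutativeRing ℚₚ.+-*-commutativeRing (λ _ → nothing)

*-reassoc : ∀ t α d m → t * α * d * m ≡ t * (d * (α * m))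
*-reassoc = solve-∀ ℚ-ring

tenfold≡fivefold+fivefold : ∀ y → ℕtoℚ 10 * y ≡ (y + y + (y + y + y)) + (y + y + (y + y + y))
tenfold≡fivefold+fivefold = solve-∀ ℚ-ring

p≤p+q : ∀ {p q} → 0ℚ ≤ q → p ≤ p + q
p≤p+q {p} {q} 0≤q = subst (_≤ p + q) (ℚₚ.+-identityʳ p) (ℚₚ.+-monoʳ-≤ p 0≤q)

fivefold≤tenfold : ∀ {y} → 0ℚ ≤ y → y + y + (y + y + y) ≤ ℕtoℚ 10 * y
fivefold≤tenfold {y} 0≤y = subst (y + y + (y + y + y) ≤_) (sym (tenfold≡fivefold+fivefold y)) (p≤p+q 0≤fivefold)
  where
  0≤fivefold : 0ℚ ≤ y + y + (y + y + y)
  0≤fivefold = ℚₚ.+-mono-≤ (ℚₚ.+-mono-≤ 0≤y 0≤y) (ℚₚ.+-mono-≤ (ℚₚ.+-mono-≤ 0≤y 0≤y) 0≤y)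

≤-tenfold : ∀ {y} → 0ℚ ≤ y → y ≤ ℕtoℚ 10 * y
≤-tenfold {y} 0≤y =
  subst (_≤ ℕtoℚ 10 * y) (ℚₚ.*-identityˡ y)
    (ℚₚ.*-monoʳ-≤-nonNeg y {{nonNegative 0≤y}} (ℕtoℚ-mono-≤ {1} {10} (ℕ.s≤s ℕ.z≤n)))

<⊎≥ : ∀ p q → p < q ⊎ q ≤ p
<⊎≥ p q with p ℚₚ.<? q
... | yes p<q = inj₁ p<q
... | no  p≮q = inj₂ (ℚₚ.≮⇒≥ p≮q)

p≤q*p : ∀ {a d} → 0ℚ ≤ a → 1ℚ ≤ d → a ≤ d * a
p≤q*p {a} {d} 0≤a 1≤d = subst (_≤ d * a) (ℚₚ.*-identityˡ a) (ℚₚ.*-monoʳ-≤-nonNeg a {{nonNegative 0≤a}} 1≤d)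

sparse-sum-bound : ∀ {a d b m t} → 0ℚ ≤ a → 1ℚ ≤ d → b ≤ a + a → m ≤ d * b → t < a →
  b + (m + t) < d * a + d * a + (d * a + d * a + d * a)
sparse-sum-bound {a} {d} {b} {m} 0≤a 1≤d b≤2a m≤db t<a =
  ℚₚ.+-mono-≤-< b≤2da (ℚₚ.+-mono-≤-< m≤2da (ℚₚ.<-≤-trans t<a a≤da))
  where
  a≤da : a ≤ d * a
  a≤da = p≤q*p 0≤a 1≤d
  b≤2da : b ≤ d * a + d * a
  b≤2da = ℚₚ.≤-trans b≤2a (ℚₚ.+-mono-≤ a≤da a≤da)
  m≤2da : m ≤ d * a + d * a
  m≤2da = ℚₚ.≤-trans m≤db (ℚₚ.≤-trans (ℚₚ.*-monoˡ-≤-nonNeg d {{nonNegative 0≤d}} b≤2a)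
                                      (ℚₚ.≤-reflexive (ℚₚ.*-distribˡ-+ d a a)))
    where
    0≤d : 0ℚ ≤ d
    0≤d = ℚₚ.≤-trans (ℚₚ.nonNegative⁻¹ 1ℚ) 1≤d

∣p∪q∣≤∣p∣+∣q∣ : ∀ {n} (p q : Subset n) → ∣ p ∪ q ∣ ℕ.≤ ∣ p ∣ ℕ.+ ∣ q ∣
∣p∪q∣≤∣p∣+∣q∣ []            []            = ℕ.z≤n
∣p∪q∣≤∣p∣+∣q∣ (outside ∷ p) (outside ∷ q) = ∣p∪q∣≤∣p∣+∣q∣ p q
∣p∪q∣≤∣p∣+∣q∣ (outside ∷ p) (inside  ∷ q) =
  ℕₚ.≤-trans (ℕ.s≤s (∣p∪q∣≤∣p∣+∣q∣ p q)) (ℕₚ.≤-reflexive (sym (ℕₚ.+-suc ∣ p ∣ ∣ q ∣)))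
∣p∪q∣≤∣p∣+∣q∣ (inside  ∷ p) (outside ∷ q) = ℕ.s≤s (∣p∪q∣≤∣p∣+∣q∣ p q)
∣p∪q∣≤∣p∣+∣q∣ (inside  ∷ p) (inside  ∷ q) =
  ℕ.s≤s (ℕₚ.≤-trans (∣p∪q∣≤∣p∣+∣q∣ p q) (ℕₚ.+-monoʳ-≤ ∣ p ∣ (ℕₚ.n≤1+n ∣ q ∣)))

disjoint-tail : ∀ {n s t} {p q : Subset n} → Disjoint (s ∷ p) (t ∷ q) → Disjoint p q
disjoint-tail p#q x x∈p x∈q = p#q (Fin.suc x) (there x∈p) (there x∈q)

∣p∪q∣≡∣p∣+∣q∣ : ∀ {n} (p q : Subset n) → Disjoint p q → ∣ p ∪ q ∣ ≡ ∣ p ∣ ℕ.+ ∣ q ∣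
∣p∪q∣≡∣p∣+∣q∣ []            []            _   = refl
∣p∪q∣≡∣p∣+∣q∣ (outside ∷ p) (outside ∷ q) p#q = ∣p∪q∣≡∣p∣+∣q∣ p q (disjoint-tail p#q)
∣p∪q∣≡∣p∣+∣q∣ (outside ∷ p) (inside  ∷ q) p#q =
  trans (cong ℕ.suc (∣p∪q∣≡∣p∣+∣q∣ p q (disjoint-tail p#q))) (sym (ℕₚ.+-suc ∣ p ∣ ∣ q ∣))
∣p∪q∣≡∣p∣+∣q∣ (inside  ∷ p) (outside ∷ q) p#q = cong ℕ.suc (∣p∪q∣≡∣p∣+∣q∣ p q (disjoint-tail p#q))
∣p∪q∣≡∣p∣+∣q∣ (inside  ∷ p) (inside  ∷ q) p#q = ⊥-elim (p#q Fin.zero here here)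

x∈p─q⇒x∉q : ∀ {n} {x : Fin n} {p q : Subset n} → x ∈ p ─ q → x ∉ q
x∈p─q⇒x∉q {p = _ ∷ p} {_ ∷ q}      (there x∈p─q) (there x∈q) = x∈p─q⇒x∉q {p = p} x∈p─q x∈q
x∈p─q⇒x∉q {p = _ ∷ _} {inside ∷ _} ()            here

p⊆q∪p─q : ∀ {n} (p q : Subset n) → p ⊆ q ∪ (p ─ q)
p⊆q∪p─q p q {x} x∈p with x ∈? q
... | yes x∈q = x∈p∪q⁺ (inj₁ x∈q)
... | no  x∉q = x∈p∪q⁺ (inj₂ (x∈p∧x∉q⇒x∈p─q x∈p x∉q))

∣p∣≤∣q∣+∣p─q∣ : ∀ {n} (p q : Subset n) → ∣ p ∣ ℕ.≤ ∣ q ∣ ℕ.+ ∣ p ─ q ∣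
∣p∣≤∣q∣+∣p─q∣ p q = ℕₚ.≤-trans (p⊆q⇒∣p∣≤∣q∣ (p⊆q∪p─q p q)) (∣p∪q∣≤∣p∣+∣q∣ q (p ─ q))

∣q∣<∣p∣⇒0<∣p─q∣ : ∀ {n} (p q : Subset n) → ∣ q ∣ ℕ.< ∣ p ∣ → 0 ℕ.< ∣ p ─ q ∣
∣q∣<∣p∣⇒0<∣p─q∣ p q q<p = ℕₚ.+-cancelˡ-< (∣ q ∣) 0 (∣ p ─ q ∣)
  (subst (ℕ._< ∣ q ∣ ℕ.+ ∣ p ─ q ∣) (sym (ℕₚ.+-identityʳ ∣ q ∣)) (ℕₚ.<-≤-trans q<p (∣p∣≤∣q∣+∣p─q∣ p q)))

p⊆r─q⇒disjoint : ∀ {n} {p q r : Subset n} → p ⊆ r ─ q → Disjoint q p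
p⊆r─q⇒disjoint p⊆r─q x x∈q x∈p = x∈p─q⇒x∉q (p⊆r─q x∈p) x∈q

∈-tabulate⁻ : ∀ {n} {f : Fin n → Bool} {x} → x ∈ tabulate f → f x ≡ true
∈-tabulate⁻ {f = f} {x} x∈ = trans (sym (lookup∘tabulate f x)) ([]=⇒lookup x∈)

∈-tabulate⁺ : ∀ {n} {f : Fin n → Bool} {x} → f x ≡ true → x ∈ tabulate f
∈-tabulate⁺ {f = f} {x} fx = lookup⇒[]= x (tabulate f) (trans (lookup∘tabulate f x) fx)

anyFin⁻ : ∀ {n} (f : Fin n → Bool) → anyFin f ≡ true → ∃ λ i → f i ≡ true
anyFin⁻ {ℕ.suc n} f any with f Fin.zero in f0≡
... | true  = Fin.zero , f0≡
... | false with anyFin⁻ (λ i → f (Fin.suc i)) any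
...   | i , fi = Fin.suc i , fi

anyFin⁺ : ∀ {n} (f : Fin n → Bool) i → f i ≡ true → anyFin f ≡ true
anyFin⁺ f Fin.zero    fi rewrite fi = refl
anyFin⁺ f (Fin.suc i) fi with f Fin.zero
... | true  = refl
... | false = anyFin⁺ (λ j → f (Fin.suc j)) i fi

-- Γ H X is definitionally neighbours (hadj H) X.
neighbours : ∀ {n} → (Fin n → Fin n → Bool) → Subset n → Subset n
neighbours A X = tabulate λ v → anyFin λ u → lookup X u ∧ A u v

∈-neighbours⁻ : ∀ {n} {A : Fin n → Fin n → Bool} {X v} → v ∈ neighbours A X → ∃ λ u → u ∈ X × A u v ≡ true
∈-neighbours⁻ {A = A} {X} {v} v∈ with anyFin⁻ (λ u → lookup X u ∧ A u v) (∈-tabulate⁻ v∈)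
... | u , X∧A = u , lookup⇒[]= u X (∧-conicalˡ _ _ X∧A) , ∧-conicalʳ _ _ X∧A

∈-neighbours⁺ : ∀ {n} {A : Fin n → Fin n → Bool} {X u v} → u ∈ X → A u v ≡ true → v ∈ neighbours A X
∈-neighbours⁺ {A = A} {X} {u} {v} u∈X Auv =
  ∈-tabulate⁺ (anyFin⁺ (λ w → lookup X w ∧ A w v) u (cong₂ _∧_ ([]=⇒lookup u∈X) Auv))

Contracting : ∀ {n} {G : Graph n} {U : Subset n} → ℚ → ℚ → SubgraphIn G U → Subset n → Set
Contracting s d H X =
  X ⊆ verts H × 1 ℕ.≤ ∣ X ∣ × ℕtoℚ ∣ X ∣ ≤ s × ℕtoℚ ∣ Γ H X ∣ < d * ℕtoℚ ∣ X ∣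

contracting? : ∀ {n} {G : Graph n} {U : Subset n} s d (H : SubgraphIn G U) X → Dec (Contracting s d H X)
contracting? s d H X = X ⊆? verts H ×-dec 1 ℕₚ.≤? ∣ X ∣ ×-dec ℕtoℚ ∣ X ∣ ℚₚ.≤? s
                       ×-dec ℕtoℚ ∣ Γ H X ∣ ℚₚ.<? d * ℕtoℚ ∣ X ∣

expanding-or-contracting : ∀ {n} {G : Graph n} {U : Subset n} s d (H : SubgraphIn G U) →
  Expanding s d H ⊎ ∃ (Contracting s d H)
expanding-or-contracting s d H = decide (anySubset? (contracting? s d H))
  where
  decide : Dec (∃ (Contracting s d H)) → Expanding s d H ⊎ ∃ (Contracting s d H)
  decide (yes contracting) = inj₂ contracting
  decide (no ¬contracting) = inj₁ λ X X⊆ 1≤∣X∣ ∣X∣≤s → ℚₚ.≮⇒≥ λ Γ< → ¬contracting (X , X⊆ , 1≤∣X∣ , ∣X∣≤s , Γ<)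

joint⇒0<threshold : ∀ {n α} {G : Graph n} → Joint α G → 0ℚ < α * ℕtoℚ n
joint⇒0<threshold {n} {α} {G} joint = ℚₚ.≰⇒> λ a≤0 → no-edge (joint ⊥ ⊥ (λ _ _ → ∉⊥) (a≤∣⊥∣ a≤0) (a≤∣⊥∣ a≤0))
  where
  a≤∣⊥∣ : α * ℕtoℚ n ≤ 0ℚ → α * ℕtoℚ n ≤ ℕtoℚ ∣ ⊥ {n} ∣
  a≤∣⊥∣ = subst (λ k → α * ℕtoℚ n ≤ ℕtoℚ k) (sym (∣⊥∣≡0 n))
  no-edge : ¬ EdgeBetween G ⊥ ⊥
  no-edge (u , _ , u∈⊥ , _) = ∉⊥ u∈⊥

module _ {n : ℕ} (G : Graph n) where

  induced : ∀ {U} W → W ⊆ U → SubgraphIn G U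
  induced W W⊆U = record
    { verts   = W
    ; verts⊆U = W⊆U
    ; hadj    = λ u v → (lookup W u ∧ lookup W v) ∧ adj G u v
    ; hsym    = λ u v → cong₂ _∧_ (∧-comm (lookup W u) (lookup W v)) (Graph.sym G u v)
    ; hedge   = λ u v W∧adj → let Wu∧Wv = ∧-conicalˡ _ _ W∧adj in
        lookup⇒[]= u W (∧-conicalˡ _ _ Wu∧Wv) , lookup⇒[]= v W (∧-conicalʳ _ _ Wu∧Wv) , ∧-conicalʳ _ _ W∧adj
    }

  N : Subset n → Subset n
  N = neighbours (adj G)

  module _ (U : Subset n) where

    boundary : Subset n → Subset n
    boundary B = (U ─ B) ∩ N B

    remainder : Subset n → SubgraphIn G U
    remainder B = induced (U ─ B) (p─q⊆p U B)

    Sparse : ℚ → Subset n → Set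
    Sparse d B = ℕtoℚ ∣ boundary B ∣ ≤ d * ℕtoℚ ∣ B ∣

    boundary-∪ : ∀ {B X} → X ⊆ U ─ B → boundary (B ∪ X) ⊆ boundary B ∪ Γ (remainder B) X
    boundary-∪ {B} {X} X⊆U─B {v} v∈∂ = via-edge (∈-neighbours⁻ {A = adj G} (proj₂ v∈U─B∪X×v∈N))
      where
      v∈U─B∪X×v∈N : v ∈ U ─ (B ∪ X) × v ∈ N (B ∪ X)
      v∈U─B∪X×v∈N = x∈p∩q⁻ (U ─ (B ∪ X)) (N (B ∪ X)) v∈∂
      v∈U─B : v ∈ U ─ B
      v∈U─B = x∈p∧x∉q⇒x∈p─q (p─q⊆p U (B ∪ X) (proj₁ v∈U─B∪X×v∈N))
                            (x∈p─q⇒x∉q (proj₁ v∈U─B∪X×v∈N) ∘ x∈p∪q⁺ ∘ inj₁)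
      via-edge : (∃ λ u → u ∈ B ∪ X × adj G u v ≡ true) → v ∈ boundary B ∪ Γ (remainder B) X
      via-edge (u , u∈B∪X , adj-uv) with x∈p∪q⁻ B X u∈B∪X
      ... | inj₁ u∈B = x∈p∪q⁺ (inj₁ (x∈p∩q⁺ (v∈U─B , ∈-neighbours⁺ {A = adj G} u∈B adj-uv)))
      ... | inj₂ u∈X = x∈p∪q⁺ (inj₂ (∈-neighbours⁺ {A = hadj (remainder B)} u∈X
                          (cong₂ _∧_ (cong₂ _∧_ ([]=⇒lookup (X⊆U─B u∈X)) ([]=⇒lookup v∈U─B)) adj-uv)))

    ℕtoℚ-∣∪∣ : ∀ {B X} → X ⊆ U ─ B → ℕtoℚ ∣ B ∪ X ∣ ≡ ℕtoℚ ∣ B ∣ + ℕtoℚ ∣ X ∣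
    ℕtoℚ-∣∪∣ {B} {X} X⊆U─B =
      trans (cong ℕtoℚ (∣p∪q∣≡∣p∣+∣q∣ B X (p⊆r─q⇒disjoint X⊆U─B))) (ℕtoℚ-homo-+ ∣ B ∣ ∣ X ∣)

    sparse-∪ : ∀ d {B X} → X ⊆ U ─ B → Sparse d B → ℕtoℚ ∣ Γ (remainder B) X ∣ ≤ d * ℕtoℚ ∣ X ∣ → Sparse d (B ∪ X)
    sparse-∪ d {B} {X} X⊆U─B sparse Γ≤ = begin
      ℕtoℚ ∣ boundary (B ∪ X) ∣                          ≤⟨ ℕtoℚ-mono-≤ (ℕₚ.≤-trans (p⊆q⇒∣p∣≤∣q∣ (boundary-∪ X⊆U─B))
                                                                          (∣p∪q∣≤∣p∣+∣q∣ (boundary B) ΓX)) ⟩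
      ℕtoℚ (∣ boundary B ∣ ℕ.+ ∣ ΓX ∣)                  ≡⟨ ℕtoℚ-homo-+ ∣ boundary B ∣ ∣ ΓX ∣ ⟩
      ℕtoℚ ∣ boundary B ∣ + ℕtoℚ ∣ ΓX ∣                 ≤⟨ ℚₚ.+-mono-≤ sparse Γ≤ ⟩
      d * ℕtoℚ ∣ B ∣ + d * ℕtoℚ ∣ X ∣                   ≡⟨ ℚₚ.*-distribˡ-+ d (ℕtoℚ ∣ B ∣) (ℕtoℚ ∣ X ∣) ⟨
      d * (ℕtoℚ ∣ B ∣ + ℕtoℚ ∣ X ∣)                     ≡⟨ cong (d *_) (ℕtoℚ-∣∪∣ X⊆U─B) ⟨
      d * ℕtoℚ ∣ B ∪ X ∣                                ∎
      where
      open ℚₚ.≤-Reasoning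
      ΓX = Γ (remainder B) X

    boundary-⊥ : boundary ⊥ ⊆ ⊥
    boundary-⊥ v∈∂ = ⊥-elim (∉⊥ (proj₁ (proj₂ (∈-neighbours⁻ {A = adj G} (proj₂ (x∈p∩q⁻ (U ─ ⊥) (N ⊥) v∈∂))))))

    sparse-⊥ : ∀ d → Sparse d ⊥
    sparse-⊥ d = subst (λ k → ℕtoℚ ∣ boundary ⊥ ∣ ≤ d * ℕtoℚ k) (sym (∣⊥∣≡0 n))
      (subst (ℕtoℚ ∣ boundary ⊥ ∣ ≤_) (sym (ℚₚ.*-zeroʳ d))
        (ℕtoℚ-mono-≤ (ℕₚ.≤-trans (p⊆q⇒∣p∣≤∣q∣ boundary-⊥) (ℕₚ.≤-reflexive (∣⊥∣≡0 n)))))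

    module _ {s d : ℚ} (gap : ∀ B → Sparse d B → ℕtoℚ ∣ B ∣ ≤ s + s → ℕtoℚ ∣ B ∣ < s) where

      grow : ∀ B → Acc ℕ._<_ (n ℕ.∸ ∣ B ∣) → Sparse d B → ℕtoℚ ∣ B ∣ < s →
             ∃ λ B → ℕtoℚ ∣ B ∣ < s × Expanding s d (remainder B)
      grow B (acc smaller) sparse small = extend (expanding-or-contracting s d (remainder B))
        where
        extend : Expanding s d (remainder B) ⊎ ∃ (Contracting s d (remainder B)) →
                 ∃ λ B → ℕtoℚ ∣ B ∣ < s × Expanding s d (remainder B)
        extend (inj₁ expanding) = B , small , expanding
        extend (inj₂ (X , X⊆U─B , 1≤∣X∣ , ∣X∣≤s , Γ<)) =
          grow (B ∪ X) (smaller (ℕₚ.∸-monoʳ-< ∣B∣<∣B∪X∣ (∣p∣≤n (B ∪ X)))) sparse′ (gap (B ∪ X) sparse′ ∣B∪X∣≤2s)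
          where
          sparse′ : Sparse d (B ∪ X)
          sparse′ = sparse-∪ d X⊆U─B sparse (ℚₚ.<⇒≤ Γ<)
          ∣B∪X∣≤2s : ℕtoℚ ∣ B ∪ X ∣ ≤ s + s
          ∣B∪X∣≤2s = subst (_≤ s + s) (sym (ℕtoℚ-∣∪∣ X⊆U─B)) (ℚₚ.+-mono-≤ (ℚₚ.<⇒≤ small) ∣X∣≤s)
          ∣B∣<∣B∪X∣ : ∣ B ∣ ℕ.< ∣ B ∪ X ∣
          ∣B∣<∣B∪X∣ = subst (∣ B ∣ ℕ.<_) (sym (∣p∪q∣≡∣p∣+∣q∣ B X (p⊆r─q⇒disjoint X⊆U─B))) (ℕₚ.m<m+n ∣ B ∣ 1≤∣X∣)

      expanding-remainder : 0ℚ < s → ∃ λ B → ℕtoℚ ∣ B ∣ < s × Expanding s d (remainder B)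
      expanding-remainder 0<s =
        grow ⊥ (<-wellFounded _) (sparse-⊥ d) (subst (λ k → ℕtoℚ k < s) (sym (∣⊥∣≡0 n)) 0<s)

    detached : Subset n → Subset n
    detached B = U ─ B ─ boundary B

    no-edge-to-detached : ∀ B → ¬ EdgeBetween G B (detached B)
    no-edge-to-detached B (u , v , u∈B , v∈T , adj-uv) =
      x∈p─q⇒x∉q v∈T (x∈p∩q⁺ (p─q⊆p (U ─ B) (boundary B) v∈T , ∈-neighbours⁺ {A = adj G} u∈B adj-uv))

    ∣U∣≤∣B∣+∣boundary∣+∣detached∣ : ∀ B → ∣ U ∣ ℕ.≤ ∣ B ∣ ℕ.+ (∣ boundary B ∣ ℕ.+ ∣ detached B ∣)
    ∣U∣≤∣B∣+∣boundary∣+∣detached∣ B =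
      ℕₚ.≤-trans (∣p∣≤∣q∣+∣p─q∣ U B) (ℕₚ.+-monoʳ-≤ ∣ B ∣ (∣p∣≤∣q∣+∣p─q∣ (U ─ B) (boundary B)))

    disjoint-detached : ∀ B → Disjoint B (detached B)
    disjoint-detached B = p⊆r─q⇒disjoint (p─q⊆p (U ─ B) (boundary B))

    module _ {α d : ℚ} (joint : Joint α G) (1≤d : 1ℚ ≤ d)
             (large : ℕtoℚ 10 * (d * (α * ℕtoℚ n)) ≤ ℕtoℚ ∣ U ∣) where

      private
        0≤a : 0ℚ ≤ α * ℕtoℚ n
        0≤a = ℚₚ.<⇒≤ (joint⇒0<threshold {α = α} {G} joint)
        0≤da : 0ℚ ≤ d * (α * ℕtoℚ n)
        0≤da = ℚₚ.≤-trans 0≤a (p≤q*p 0≤a 1≤d)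

      threshold≤∣U∣ : α * ℕtoℚ n ≤ ℕtoℚ ∣ U ∣
      threshold≤∣U∣ = ℚₚ.≤-trans (p≤q*p 0≤a 1≤d) (ℚₚ.≤-trans (≤-tenfold 0≤da) large)

      sparse-gap : ∀ B → Sparse d B → ℕtoℚ ∣ B ∣ ≤ α * ℕtoℚ n + α * ℕtoℚ n → ℕtoℚ ∣ B ∣ < α * ℕtoℚ n
      sparse-gap B sparse ∣B∣≤2a = decidable-stable (ℕtoℚ ∣ B ∣ ℚₚ.<? a) λ ¬small →
        [ too-few-vertices , no-edge-to-detached B ∘ joint B T (disjoint-detached B) (ℚₚ.≮⇒≥ ¬small) ]′
          (<⊎≥ (ℕtoℚ ∣ T ∣) a)
        where
        a y : ℚ
        a = α * ℕtoℚ n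
        y = d * a
        T : Subset n
        T = detached B
        too-few-vertices : ¬ (ℕtoℚ ∣ T ∣ < a)
        too-few-vertices T-small = ℚₚ.<-irrefl refl (begin-strict
          ℕtoℚ ∣ U ∣                                         ≤⟨ ℕtoℚ-mono-≤ (∣U∣≤∣B∣+∣boundary∣+∣detached∣ B) ⟩
          ℕtoℚ (∣ B ∣ ℕ.+ (∣ boundary B ∣ ℕ.+ ∣ T ∣))         ≡⟨ ℕtoℚ-homo-+ ∣ B ∣ (∣ boundary B ∣ ℕ.+ ∣ T ∣) ⟩
          ℕtoℚ ∣ B ∣ + ℕtoℚ (∣ boundary B ∣ ℕ.+ ∣ T ∣)       ≡⟨ cong (ℕtoℚ ∣ B ∣ +_) (ℕtoℚ-homo-+ ∣ boundary B ∣ ∣ T ∣) ⟩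
          ℕtoℚ ∣ B ∣ + (ℕtoℚ ∣ boundary B ∣ + ℕtoℚ ∣ T ∣)    <⟨ sparse-sum-bound 0≤a 1≤d ∣B∣≤2a sparse T-small ⟩
          y + y + (y + y + y)                                ≤⟨ fivefold≤tenfold 0≤da ⟩
          ℕtoℚ 10 * y                                        ≤⟨ large ⟩
          ℕtoℚ ∣ U ∣                                         ∎)
          where open ℚₚ.≤-Reasoning

lemmaA3 : (n : ℕ) (G : Graph n) (α d : ℚ) → 0ℚ < α → Joint α G → 1ℚ ≤ d →
    (U : Subset n) → ℕtoℚ 10 * α * d * ℕtoℚ n ≤ ℕtoℚ ∣ U ∣ →
    Σ (SubgraphIn G U) λ H → 1 Data.Nat.≤ ∣ verts H ∣ × Expanding (α * ℕtoℚ n) d H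
lemmaA3 n G α d _ joint 1≤d U large′ =
  conclude (expanding-remainder G U {a} {d} (sparse-gap G U {α} joint 1≤d large)
                                            (joint⇒0<threshold {α = α} {G} joint))
  where
  a : ℚ
  a = α * ℕtoℚ n
  large : ℕtoℚ 10 * (d * a) ≤ ℕtoℚ ∣ U ∣
  large = subst (_≤ ℕtoℚ ∣ U ∣) (*-reassoc (ℕtoℚ 10) α d (ℕtoℚ n)) large′
  conclude : (∃ λ B → ℕtoℚ ∣ B ∣ < a × Expanding a d (remainder G U B)) →
             Σ (SubgraphIn G U) λ H → 1 Data.Nat.≤ ∣ verts H ∣ × Expanding a d H
  conclude (B , ∣B∣<a , expanding) =
    remainder G U B , ∣q∣<∣p∣⇒0<∣p─q∣ U B ∣B∣<∣U∣ , expanding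
    where
    ∣B∣<∣U∣ : ∣ B ∣ ℕ.< ∣ U ∣
    ∣B∣<∣U∣ = ℕtoℚ-cancel-< (ℚₚ.<-≤-trans ∣B∣<a (threshold≤∣U∣ G U {α} joint 1≤d large))
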